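{- Let $k\ge 0$, let $G,G'$ be graphs and $v\in V(G)$, $v'\in V(G')$ with $|V(G)|=|V(G')|\ge 2$ and $\gamma^G(v)=\gamma^{G'}(v')$. Then the following are equivalent. (i) Duplicator has a winning strategy for the $k$-round bijective pebble game on $G,G'$ with initial position $((v),(v'))$. (ii) Duplicator has a winning strategy for the $k$-round bijective pebble game on $G\wr v$, $G'\wr v'$ (with the empty initial position).
   Context: Graphs are finite, undirected, vertex-coloured triples $(V(G),E(G),\gamma^G)$. For a graph $G$ and $v\in V(G)$, $G\wr v$ is the graph with vertex set $V(G)\setminus\{v\}$, edges those of $G$ with both ends in $V(G)\setminus\{v\}$, and colouring $\gamma^{G\wr v}(w)=(\gamma^G(w),1)$ if $vw\in E(G)$ and $(\gamma^G(w),0)$ otherwise. Bijective pebble game on graphs $G,G'$ of the same order: positions are pairs $(\vec v,\vec v')$ of tuples of equal length $\ell$ with $\vec v\in V(G)^\ell,\vec v'\in V(G')^\ell$; the default initial position is the pair of empty tuples. In each round Duplicator chooses a bijection $f:V(G)\to V(G')$, then Spoiler chooses $u\in V(G)$, and $u$ and $f(u)$ are appended to $\vec v$ and $\vec v'$ respectively. After $k$ rounds, with final position $((v_1,\dots,v_n),(v'_1,\dots,v'_n))$, Duplicator wins iff for all $i,j$: $v_i=v_j\iff v'_i=v'_j$, $v_iv_j\in E(G)\iff v'_iv'_j\in E(G')$, and $\gamma^G(v_i)=\gamma^{G'}(v'_i)$; otherwise Spoiler wins. Winning strategies are defined as usual. -}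

module Defs where

open import Data.Nat using (ℕ; zero; suc)
open import Data.Fin using (Fin; punchIn)
open import Data.Bool using (Bool)
open import Data.List using (List; []; _∷ʳ_; length; lookup)
open import Data.Product using (_×_; _,_; proj₁; proj₂; Σ)
open import Function.Bundles using (_⤖_; Bijection)
open import Relation.Binary.PropositionalEquality using (_≡_)
open import Relation.Nullary using (¬_)

record Graph (C : Set) (n : ℕ) : Set where
  field
    adj    : Fin n → Fin n → Bool
    col    : Fin n → C
    sym    : ∀ u w → adj u w ≡ adj w u
    irrefl : ∀ u → adj u u ≡ Data.Bool.false

open Graph public

-- G ≀ v : delete v; vertex set V(G) ∖ {v} is represented by Fin m via
-- punchIn v; new colour (γ(w), 1) iff vw ∈ E(G), with 1 = true, 0 = false.
_≀_ : ∀ {C m} → Graph C (suc m) → Fin (suc m) → Graph (C × Bool) m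
adj    (G ≀ v) u w = adj G (punchIn v u) (punchIn v w)
col    (G ≀ v) w   = col G (punchIn v w) , adj G v (punchIn v w)
sym    (G ≀ v) u w = sym G (punchIn v u) (punchIn v w)
irrefl (G ≀ v) u   = irrefl G (punchIn v u)

-- A position: the list of pebbled pairs (v_i , v'_i), i.e. the pair of
-- tuples (v⃗ , v⃗') of equal length.
Position : ∀ {C n n'} → Graph C n → Graph C n' → Set
Position {n = n} {n'} _ _ = List (Fin n × Fin n')

Winning : ∀ {C n n'} (G : Graph C n) (G' : Graph C n') → Position G G' → Set
Winning G G' p =
  ∀ (i j : Fin (length p)) →
    let vi  = proj₁ (lookup p i) ; vj  = proj₁ (lookup p j)
        vi' = proj₂ (lookup p i) ; vj' = proj₂ (lookup p j)
    in ((vi ≡ vj → vi' ≡ vj') × (vi' ≡ vj' → vi ≡ vj))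
     × (adj G vi vj ≡ adj G' vi' vj')
     × (col G vi ≡ col G' vi')

DupWins : ∀ {C n n'} (G : Graph C n) (G' : Graph C n') → ℕ → Position G G' → Set
DupWins G G' zero    p = Winning G G' p
DupWins {n = n} {n'} G G' (suc k) p =
  Σ (Fin n ⤖ Fin n') λ f → ∀ (u : Fin n) → DupWins G G' k (p ∷ʳ (u , Bijection.to f u))

-- Once v and v' are pebbled, a position is winning iff it is a partial
-- isomorphism containing (v , v'), and away from that pair this says
-- exactly that the punched-in pairs form a partial isomorphism that also
-- respects adjacency to v and v' — the information the colours of G ≀ v
-- and G' ≀ v' record.  Duplicator's bijections correspond as well: in the
-- rooted game a winning bijection must send v to v', so it restricts to a
-- bijection of the remaining vertices, and conversely a bijection of the
-- remaining vertices extends by v ↦ v'.  If Spoiler pebbles v he merely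
-- repeats (v , v') and wastes a round; absorbing this needs G ≀ v to have
-- a vertex, hence the order at least 2.
module Submission where

open import Defs hiding (sym)
open import Data.Nat using (ℕ; zero; suc)
open import Data.Fin using (Fin; punchIn; punchOut)
open import Data.Fin.Patterns using (0F)
open import Data.Fin.Properties using (_≟_; punchIn-injective; punchInᵢ≢i; punchIn-punchOut)
open import Data.Fin.Permutation using (Permutation; _⟨$⟩ʳ_; remove; insert; insert-punchIn; punchIn-permute)
open import Data.List using ([]; [_]; _∷_; _∷ʳ_; map)
open import Data.List.Properties using (map-++)
open import Data.List.Membership.Propositional using (_∈_)
open import Data.List.Membership.Propositional.Properties using (∈-lookup; ∈-++⁺ʳ; ∈-++⁻; ∈-map⁺; ∈-map⁻)
open import Data.List.Relation.Unary.Any using (here; there; index)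
open import Data.List.Relation.Unary.Any.Properties using (lookup-index)
open import Data.List.Relation.Binary.Subset.Propositional using (_⊆_)
open import Data.List.Relation.Binary.Subset.Propositional.Properties using (xs⊆xs++ys; ++⁺ˡ)
open import Data.Product using (_×_; _,_; proj₁; proj₂)
open import Data.Sum using (inj₁; inj₂)
open import Function.Bundles using (_⇔_; mk⇔)
open import Function.Properties.Bijection using (⤖⇒↔)
open import Function.Properties.Inverse using (↔⇒⤖)
open import Relation.Nullary using (yes; no; contradiction)
open import Relation.Binary.PropositionalEquality
  using (_≡_; refl; sym; trans; cong; cong₂; subst; subst₂; module ≡-Reasoning)

data PunchInView {n} (i : Fin (suc n)) : Fin (suc n) → Set where
  at      : PunchInView i i
  punched : ∀ j → PunchInView i (punchIn i j)

punchInView : ∀ {n} (i j : Fin (suc n)) → PunchInView i j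
punchInView i j with i ≟ j
... | yes refl = at
... | no i≢j   = subst (PunchInView i) (punchIn-punchOut i≢j) (punched (punchOut i≢j))

insert-self : ∀ {m n} i j (π : Permutation m n) → insert i j π ⟨$⟩ʳ i ≡ j
insert-self i j π with i ≟ i
... | yes _  = refl
... | no i≢i = contradiction refl i≢i

∷ʳ-⊆ : ∀ {A : Set} {x : A} {xs} → x ∈ xs → xs ∷ʳ x ⊆ xs
∷ʳ-⊆ {xs = xs} x∈xs y∈ with ∈-++⁻ xs y∈
... | inj₁ y∈xs         = y∈xs
... | inj₂ (here refl) = x∈xs

module _ {C : Set} {n n' : ℕ} (G : Graph C n) (G' : Graph C n') where

  Compatible : Fin n × Fin n' → Fin n × Fin n' → Set
  Compatible (u , u') (w , w') =
    ((u ≡ w → u' ≡ w') × (u' ≡ w' → u ≡ w))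
    × adj G u w ≡ adj G' u' w'
    × col G u ≡ col G' u'

  PartialIso : Position G G' → Set
  PartialIso p = ∀ {x y} → x ∈ p → y ∈ p → Compatible x y

  winning⇒partialIso : ∀ {p} → Winning G G' p → PartialIso p
  winning⇒partialIso W x∈p y∈p =
    subst₂ Compatible (sym (lookup-index x∈p)) (sym (lookup-index y∈p))
      (W (index x∈p) (index y∈p))

  partialIso⇒winning : ∀ {p} → PartialIso p → Winning G G' p
  partialIso⇒winning P i j = P (∈-lookup i) (∈-lookup j)

  partialIso-functional : ∀ {p u u' w'} → PartialIso p →
                          (u , u') ∈ p → (u , w') ∈ p → u' ≡ w'
  partialIso-functional P x∈p y∈p = proj₁ (proj₁ (P x∈p y∈p)) refl

  DupWins-antitone : ∀ k {p q} → p ⊆ q → DupWins G G' k q → DupWins G G' k p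
  DupWins-antitone zero    p⊆q W       =
    partialIso⇒winning λ x∈p y∈p → winning⇒partialIso W (p⊆q x∈p) (p⊆q y∈p)
  DupWins-antitone (suc k) p⊆q (f , h) = f , λ u → DupWins-antitone k (++⁺ˡ _ p⊆q) (h u)

  DupWins-suc⇒DupWins : Fin n → ∀ k {p} → DupWins G G' (suc k) p → DupWins G G' k p
  DupWins-suc⇒DupWins u zero    {p} (f , h) = DupWins-antitone zero (xs⊆xs++ys p _) (h u)
  DupWins-suc⇒DupWins u (suc k)     (f , h) = f , λ w → DupWins-suc⇒DupWins u k (h w)

  DupWins⇒partialIso : Fin n → ∀ k {p} → DupWins G G' k p → PartialIso p
  DupWins⇒partialIso u zero    W = winning⇒partialIso W
  DupWins⇒partialIso u (suc k) W = DupWins⇒partialIso u k (DupWins-suc⇒DupWins u k W)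

module _ {C : Set} {n : ℕ} (G G' : Graph C (suc n)) (v v' : Fin (suc n)) where

  lift : Fin n × Fin n → Fin (suc n) × Fin (suc n)
  lift (a , a') = punchIn v a , punchIn v' a'

  rooted : Position (G ≀ v) (G' ≀ v') → Position G G'
  rooted q = (v , v') ∷ map lift q

  rooted-∷ʳ : ∀ q x → rooted (q ∷ʳ x) ≡ rooted q ∷ʳ lift x
  rooted-∷ʳ q x = cong ((v , v') ∷_) (map-++ lift q [ x ])

  compatible-root : col G v ≡ col G' v' → Compatible G G' (v , v') (v , v')
  compatible-root col≡ =
    ((λ _ → refl) , (λ _ → refl)) , trans (irrefl G v) (sym (irrefl G' v')) , col≡

  compatible-root-lift : col G v ≡ col G' v' → ∀ {y} →
                         Compatible (G ≀ v) (G' ≀ v') y y → Compatible G G' (v , v') (lift y)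
  compatible-root-lift col≡ {b , b'} (_ , _ , colᵇ≡) =
    ((λ eq → contradiction (sym eq) (punchInᵢ≢i v b))
    , (λ eq → contradiction (sym eq) (punchInᵢ≢i v' b')))
    , cong proj₂ colᵇ≡ , col≡

  compatible-lift-root : ∀ {x} →
                         Compatible (G ≀ v) (G' ≀ v') x x → Compatible G G' (lift x) (v , v')
  compatible-lift-root {a , a'} (_ , _ , colᵃ≡) =
    ((λ eq → contradiction eq (punchInᵢ≢i v a)) , (λ eq → contradiction eq (punchInᵢ≢i v' a')))
    , trans (Graph.sym G _ v) (trans (cong proj₂ colᵃ≡) (Graph.sym G' v' _))
    , cong proj₁ colᵃ≡

  compatible-lift : ∀ {x y} →
                    Compatible (G ≀ v) (G' ≀ v') x y → Compatible G G' (lift x) (lift y)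
  compatible-lift {a , a'} {b , b'} ((a≡b⇒ , a'≡b'⇒) , adj≡ , colᵃ≡) =
    ((λ eq → cong (punchIn v') (a≡b⇒ (punchIn-injective v a b eq)))
    , (λ eq → cong (punchIn v) (a'≡b'⇒ (punchIn-injective v' a' b' eq))))
    , adj≡ , cong proj₁ colᵃ≡

  compatible-unlift : ∀ {x y} → Compatible G G' (v , v') (lift x) →
                      Compatible G G' (lift x) (lift y) → Compatible (G ≀ v) (G' ≀ v') x y
  compatible-unlift {a , a'} {b , b'} (_ , adjᵛᵃ≡ , _) ((a≡b⇒ , a'≡b'⇒) , adj≡ , colᵃ≡) =
    ((λ eq → punchIn-injective v' a' b' (a≡b⇒ (cong (punchIn v) eq)))
    , (λ eq → punchIn-injective v a b (a'≡b'⇒ (cong (punchIn v') eq))))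
    , adj≡ , cong₂ _,_ colᵃ≡ adjᵛᵃ≡

  partialIso-rooted⁻ : ∀ {q} → PartialIso G G' (rooted q) → PartialIso (G ≀ v) (G' ≀ v') q
  partialIso-rooted⁻ P x∈q y∈q =
    compatible-unlift (P (here refl) (there (∈-map⁺ lift x∈q)))
                      (P (there (∈-map⁺ lift x∈q)) (there (∈-map⁺ lift y∈q)))

  partialIso-rooted⁺ : col G v ≡ col G' v' → ∀ {q} →
                       PartialIso (G ≀ v) (G' ≀ v') q → PartialIso G G' (rooted q)
  partialIso-rooted⁺ col≡ P (here refl) (here refl) = compatible-root col≡
  partialIso-rooted⁺ col≡ P (here refl) (there y∈) with ∈-map⁻ lift y∈
  ... | _ , y∈q , refl = compatible-root-lift col≡ (P y∈q y∈q)
  partialIso-rooted⁺ col≡ P (there x∈) (here refl) with ∈-map⁻ lift x∈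
  ... | _ , x∈q , refl = compatible-lift-root (P x∈q x∈q)
  partialIso-rooted⁺ col≡ P (there x∈) (there y∈) with ∈-map⁻ lift x∈ | ∈-map⁻ lift y∈
  ... | _ , x∈q , refl | _ , y∈q , refl = compatible-lift (P x∈q y∈q)

  DupWins-rooted⁻ : ∀ k q → DupWins G G' k (rooted q) → DupWins (G ≀ v) (G' ≀ v') k q
  DupWins-rooted⁻ zero    q W       =
    partialIso⇒winning (G ≀ v) (G' ≀ v') (partialIso-rooted⁻ (winning⇒partialIso G G' W))
  DupWins-rooted⁻ (suc k) q (f , h) = ↔⇒⤖ (remove v π) , λ a →
    DupWins-rooted⁻ k _ (subst (DupWins G G' k) (respond a) (h (punchIn v a)))
    where
    π = ⤖⇒↔ f

    v↦v' : π ⟨$⟩ʳ v ≡ v'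
    v↦v' = sym (partialIso-functional G G' (DupWins⇒partialIso G G' v k (h v))
                 (here refl) (∈-++⁺ʳ (rooted q) (here refl)))

    respond : ∀ a → rooted q ∷ʳ (punchIn v a , π ⟨$⟩ʳ punchIn v a)
                  ≡ rooted (q ∷ʳ (a , remove v π ⟨$⟩ʳ a))
    respond a = begin
      rooted q ∷ʳ (punchIn v a , π ⟨$⟩ʳ punchIn v a)
        ≡⟨ cong (λ w → rooted q ∷ʳ (punchIn v a , w)) (punchIn-permute π v a) ⟩
      rooted q ∷ʳ (punchIn v a , punchIn (π ⟨$⟩ʳ v) (remove v π ⟨$⟩ʳ a))
        ≡⟨ cong (λ w → rooted q ∷ʳ (punchIn v a , punchIn w (remove v π ⟨$⟩ʳ a))) v↦v' ⟩
      rooted q ∷ʳ lift (a , remove v π ⟨$⟩ʳ a)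
        ≡⟨ sym (rooted-∷ʳ q _) ⟩
      rooted (q ∷ʳ (a , remove v π ⟨$⟩ʳ a))
        ∎
      where open ≡-Reasoning

  DupWins-rooted⁺ : Fin n → col G v ≡ col G' v' →
                    ∀ k q → DupWins (G ≀ v) (G' ≀ v') k q → DupWins G G' k (rooted q)
  DupWins-rooted⁺ u col≡ zero    q W       =
    partialIso⇒winning G G' (partialIso-rooted⁺ col≡ (winning⇒partialIso (G ≀ v) (G' ≀ v') W))
  DupWins-rooted⁺ u col≡ (suc k) q (g , h) = ↔⇒⤖ π , respond
    where
    π = insert v v' (⤖⇒↔ g)

    respond : ∀ w → DupWins G G' k (rooted q ∷ʳ (w , π ⟨$⟩ʳ w))
    respond w with punchInView v w
    ... | at = subst (λ w' → DupWins G G' k (rooted q ∷ʳ (v , w'))) (sym (insert-self v v' _))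
                 (DupWins-antitone G G' k (∷ʳ-⊆ (here refl))
                   (DupWins-rooted⁺ u col≡ k q
                     (DupWins-suc⇒DupWins (G ≀ v) (G' ≀ v') u k (g , h))))
    ... | punched a =
      subst (DupWins G G' k)
        (trans (rooted-∷ʳ q _)
               (cong (λ w' → rooted q ∷ʳ (punchIn v a , w')) (sym (insert-punchIn v v' _ a))))
        (DupWins-rooted⁺ u col≡ k _ (h a))

lemma20 : ∀ {C : Set} (k m : ℕ) (G G' : Graph C (suc (suc m)))
    (v v' : Fin (suc (suc m))) →
    col G v ≡ col G' v' →
    DupWins G G' k [ (v , v') ] ⇔ DupWins (G ≀ v) (G' ≀ v') k []
lemma20 k m G G' v v' col≡ =
  mk⇔ (DupWins-rooted⁻ G G' v v' k []) (DupWins-rooted⁺ G G' v v' 0F col≡ k [])
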